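{- Let $n\ge 4$ be an integer and let $x=\binom{n}{3}-2(n-2)$. Then $k_5(k_3\le x)\ge \binom{n}{5}-2\binom{n-2}{3}+(n-4)$.
   Context: All graphs are finite simple graphs. A binomial coefficient $\binom{a}{b}$ with $a<b$ is taken to be $0$. For a graph $g$, $k_r(g)$ is the number of complete subgraphs $K_r$ of $g$. For $r<s$ and a non-negative integer $x$, $k_s(k_r\le x)$ denotes the maximum of $k_s(g)$ over all graphs $g$ with $k_r(g)\le x$. -}

module Defs where

open import Data.Nat using (ℕ; zero; suc; _≡ᵇ_)
open import Data.Bool using (Bool; true; false; _∧_; _∨_; not; if_then_else_)
open import Data.Fin using (Fin)
open import Data.Fin.Subset using (Subset; ∣_∣; inside; outside)
open import Data.Fin.Properties using (_≟_)
open import Data.Vec using (Vec; []; _∷_; lookup)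
open import Data.Vec.Base as Vec using ()
open import Data.List using (List; []; _∷_; _++_; map)
open import Data.Nat.ListAction using (sum)
open import Relation.Nullary.Decidable using (⌊_⌋)
open import Relation.Binary.PropositionalEquality using (_≡_)

record Graph : Set where
  field
    order  : ℕ
    adj    : Fin order → Fin order → Bool
    sym    : ∀ i j → adj i j ≡ adj j i
    irrefl : ∀ i → adj i i ≡ false
open Graph public

allSubsets : (m : ℕ) → List (Subset m)
allSubsets zero    = [] ∷ []
allSubsets (suc m) = map (outside ∷_) (allSubsets m) ++ map (inside ∷_) (allSubsets m)

allFinB : (m : ℕ) → (Fin m → Bool) → Bool
allFinB m p = Vec.foldr _ _∧_ true (Vec.tabulate p)

isCliqueB : (g : Graph) → Subset (order g) → Bool
isCliqueB g s = allFinB (order g) λ i → allFinB (order g) λ j →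
  not (lookup s i ∧ lookup s j) ∨ ⌊ i ≟ j ⌋ ∨ adj g i j

k : ℕ → Graph → ℕ
k r g = sum (map (λ s → if (∣ s ∣ ≡ᵇ r) ∧ isCliqueB g s then 1 else 0) (allSubsets (order g)))

module Submission where

open import Defs
open import Data.Nat using (ℕ; zero; suc; _+_; _*_; _∸_; _≤_; z≤n; s≤s; _≡ᵇ_)
open import Data.Nat.Properties
  using (+-suc; +-comm; +-identityʳ; *-distribˡ-+; ≤-reflexive; +-commutativeSemigroup)
open import Data.Nat.Combinatorics using (_C_; nCk+nC[k+1]≡[n+1]C[k+1]; nC1≡n)
open import Data.Nat.ListAction using (sum)
open import Data.Nat.ListAction.Properties using (sum-++)
open import Data.Bool using (Bool; true; false; _∧_; _∨_; _xor_; not; if_then_else_)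
open import Data.Bool.Properties using (xor-comm; xor-same; ∨-zeroʳ)
open import Data.Fin using (Fin) renaming (zero to fzero; suc to fsuc)
open import Data.Fin.Subset using (Subset; ∣_∣; inside; outside)
open import Data.Fin.Properties using (_≟_)
open import Data.Vec using (_∷_; []; lookup; foldr)
open import Data.Vec.Properties using (tabulate-cong)
open import Data.List using (List; []; _∷_; _++_; map)
open import Data.List.Properties using (map-++; map-∘; map-cong)
open import Algebra.Properties.CommutativeSemigroup +-commutativeSemigroup using (interchange)
open import Relation.Nullary.Decidable using (⌊_⌋; yes; no)
open import Relation.Binary.PropositionalEquality
  using (_≡_; refl; cong; cong₂; trans; module ≡-Reasoning)
  renaming (sym to ≡-sym)
open import Data.Product using (Σ; _×_; _,_)
open import Function using (_∘_)

-- The extremal graph is K_n minus two disjoint edges, i.e. K_{n-4} joined to the 4-cycle,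
-- and its clique counts satisfy k_r + 2 C(n-2, r-2) = C(n, r) + C(n-4, r-4) for every r.
-- Adding a cone vertex adds the (r-1)-cliques to the r-cliques, so along iterated cones
-- both sides obey Pascal's rule; hence they agree everywhere once they agree on the
-- 4-cycle itself, whose clique counts 1, 4, 4, 0, 0, … are computed directly.

cone : Graph → Graph
cone g = record { order = suc (order g) ; adj = coneAdj ; sym = coneSym ; irrefl = coneIrrefl }
  where
  coneAdj : Fin (suc (order g)) → Fin (suc (order g)) → Bool
  coneAdj fzero    fzero    = false
  coneAdj fzero    (fsuc _) = true
  coneAdj (fsuc _) fzero    = true
  coneAdj (fsuc i) (fsuc j) = adj g i j

  coneSym : ∀ i j → coneAdj i j ≡ coneAdj j i
  coneSym fzero    fzero    = refl
  coneSym fzero    (fsuc _) = refl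
  coneSym (fsuc _) fzero    = refl
  coneSym (fsuc i) (fsuc j) = sym g i j

  coneIrrefl : ∀ i → coneAdj i i ≡ false
  coneIrrefl fzero    = refl
  coneIrrefl (fsuc i) = irrefl g i

coneⁿ : ℕ → Graph → Graph
coneⁿ zero    g = g
coneⁿ (suc m) g = cone (coneⁿ m g)

allFinB-cong : ∀ m {p q : Fin m → Bool} → (∀ i → p i ≡ q i) → allFinB m p ≡ allFinB m q
allFinB-cong m p≗q = cong (foldr _ _∧_ true) (tabulate-cong p≗q)

allFinB-true : ∀ m (p : Fin m → Bool) → (∀ i → p i ≡ true) → allFinB m p ≡ true
allFinB-true zero    p p≡true = refl
allFinB-true (suc m) p p≡true
  rewrite p≡true fzero = allFinB-true m (p ∘ fsuc) (p≡true ∘ fsuc)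

⌊fsuc≟fsuc⌋ : ∀ {m} (i j : Fin m) → ⌊ fsuc i ≟ fsuc j ⌋ ≡ ⌊ i ≟ j ⌋
⌊fsuc≟fsuc⌋ i j with i ≟ j
... | yes refl = refl
... | no  _    = refl

-- The apex is adjacent to everything, so the clique condition is only tested on g.
isCliqueB-cone : ∀ g b (s : Subset (order g)) → isCliqueB (cone g) (b ∷ s) ≡ isCliqueB g s
isCliqueB-cone g b s = cong₂ _∧_ apexRow (allFinB-cong (order g) otherRow)
  where
  apexRow : allFinB (suc (order g))
              (λ j → not (b ∧ lookup (b ∷ s) j) ∨ ⌊ fzero ≟ j ⌋ ∨ adj (cone g) fzero j) ≡ true
  apexRow = allFinB-true (suc (order g))
    (λ j → not (b ∧ lookup (b ∷ s) j) ∨ ⌊ fzero ≟ j ⌋ ∨ adj (cone g) fzero j) λ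
    { fzero    → ∨-zeroʳ (not (b ∧ b))
    ; (fsuc j) → ∨-zeroʳ (not (b ∧ lookup s j)) }

  otherRow : ∀ i → allFinB (suc (order g))
                     (λ j → not (lookup s i ∧ lookup (b ∷ s) j) ∨ ⌊ fsuc i ≟ j ⌋ ∨ adj (cone g) (fsuc i) j)
                 ≡ allFinB (order g) (λ j → not (lookup s i ∧ lookup s j) ∨ ⌊ i ≟ j ⌋ ∨ adj g i j)
  otherRow i = cong₂ _∧_ (∨-zeroʳ (not (lookup s i ∧ b)))
    (allFinB-cong (order g) λ j →
      cong (λ e → not (lookup s i ∧ lookup s j) ∨ e ∨ adj g i j) (⌊fsuc≟fsuc⌋ i j))

sum-allSubsets-suc : ∀ m (f : Subset (suc m) → ℕ) →
  sum (map f (allSubsets (suc m)))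
    ≡ sum (map (f ∘ (outside ∷_)) (allSubsets m)) + sum (map (f ∘ (inside ∷_)) (allSubsets m))
sum-allSubsets-suc m f = begin
  sum (map f (map (outside ∷_) S ++ map (inside ∷_) S))
    ≡⟨ cong sum (map-++ f (map (outside ∷_) S) (map (inside ∷_) S)) ⟩
  sum (map f (map (outside ∷_) S) ++ map f (map (inside ∷_) S))
    ≡⟨ sum-++ (map f (map (outside ∷_) S)) (map f (map (inside ∷_) S)) ⟩
  sum (map f (map (outside ∷_) S)) + sum (map f (map (inside ∷_) S))
    ≡⟨ cong₂ (λ xs ys → sum xs + sum ys) (≡-sym (map-∘ S)) (≡-sym (map-∘ S)) ⟩
  sum (map (f ∘ (outside ∷_)) S) + sum (map (f ∘ (inside ∷_)) S) ∎
  where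
  open ≡-Reasoning
  S = allSubsets m

sum-map-zero : ∀ {A : Set} (xs : List A) → sum (map (λ _ → 0) xs) ≡ 0
sum-map-zero []       = refl
sum-map-zero (_ ∷ xs) = sum-map-zero xs

k-cone : ∀ r g → k r (cone g)
  ≡ k r g + sum (map (λ s → if (suc ∣ s ∣ ≡ᵇ r) ∧ isCliqueB g s then 1 else 0) (allSubsets (order g)))
k-cone r g = trans (sum-allSubsets-suc (order g) _)
  (cong₂ _+_ (sum-map-cong λ s → indicator-cone outside s) (sum-map-cong λ s → indicator-cone inside s))
  where
  sum-map-cong : ∀ {f h : Subset (order g) → ℕ} → (∀ s → f s ≡ h s) →
                 sum (map f (allSubsets (order g))) ≡ sum (map h (allSubsets (order g)))
  sum-map-cong f≗h = cong sum (map-cong f≗h (allSubsets (order g)))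

  indicator-cone : ∀ b s → (if (∣ b ∷ s ∣ ≡ᵇ r) ∧ isCliqueB (cone g) (b ∷ s) then 1 else 0)
                         ≡ (if (∣ b ∷ s ∣ ≡ᵇ r) ∧ isCliqueB g s then 1 else 0)
  indicator-cone b s = cong (λ c → if (∣ b ∷ s ∣ ≡ᵇ r) ∧ c then 1 else 0) (isCliqueB-cone g b s)

k-cone-zero : ∀ g → k 0 (cone g) ≡ k 0 g
k-cone-zero g = begin
  k 0 (cone g)                                       ≡⟨ k-cone 0 g ⟩
  k 0 g + sum (map (λ _ → 0) (allSubsets (order g))) ≡⟨ cong (k 0 g +_) (sum-map-zero (allSubsets (order g))) ⟩
  k 0 g + 0                                          ≡⟨ +-identityʳ (k 0 g) ⟩
  k 0 g ∎
  where open ≡-Reasoning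

k-cone-suc : ∀ r g → k (suc r) (cone g) ≡ k (suc r) g + k r g
k-cone-suc r = k-cone (suc r)

record Pascal (f : ℕ → ℕ → ℕ) : Set where
  field
    column-zero : ∀ m → f 0 (suc m) ≡ f 0 m
    step        : ∀ r m → f (suc r) (suc m) ≡ f (suc r) m + f r m
open Pascal

pascal-unique : ∀ {f h} → Pascal f → Pascal h → (∀ r → f r 0 ≡ h r 0) → ∀ r m → f r m ≡ h r m
pascal-unique pf ph base r       zero    = base r
pascal-unique pf ph base zero    (suc m) =
  trans (column-zero pf m) (trans (pascal-unique pf ph base 0 m) (≡-sym (column-zero ph m)))
pascal-unique pf ph base (suc r) (suc m) =
  trans (step pf r m)
    (trans (cong₂ _+_ (pascal-unique pf ph base (suc r) m) (pascal-unique pf ph base r m))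
           (≡-sym (step ph r m)))

pascal-+ : ∀ {f h} → Pascal f → Pascal h → Pascal (λ r m → f r m + h r m)
pascal-+ {f} {h} pf ph = record
  { column-zero = λ m → cong₂ _+_ (column-zero pf m) (column-zero ph m)
  ; step        = λ r m → trans (cong₂ _+_ (step pf r m) (step ph r m))
                                (interchange (f (suc r) m) (f r m) (h (suc r) m) (h r m))
  }

pascal-* : ∀ c {f} → Pascal f → Pascal (λ r m → c * f r m)
pascal-* c {f} pf = record
  { column-zero = λ m → cong (c *_) (column-zero pf m)
  ; step        = λ r m → trans (cong (c *_) (step pf r m)) (*-distribˡ-+ c (f (suc r) m) (f r m))
  }

pascal-k-coneⁿ : ∀ g → Pascal (λ r m → k r (coneⁿ m g))
pascal-k-coneⁿ g = record
  { column-zero = λ m → k-cone-zero (coneⁿ m g)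
  ; step        = λ r m → k-cone-suc r (coneⁿ m g)
  }

-- n C[ r ∸ d ] is the binomial coefficient of n over r - d, taken to be 0 when r < d
-- (unlike n C (r ∸ d), which would be 1 there).
_C[_∸_] : ℕ → ℕ → ℕ → ℕ
n C[ r     ∸ zero  ] = n C r
n C[ zero  ∸ suc d ] = 0
n C[ suc r ∸ suc d ] = n C[ r ∸ d ]

C[∸]-pascal : ∀ n r d → suc n C[ suc r ∸ d ] ≡ n C[ suc r ∸ d ] + n C[ r ∸ d ]
C[∸]-pascal n r       zero    = trans (≡-sym (nCk+nC[k+1]≡[n+1]C[k+1] n r)) (+-comm (n C r) _)
C[∸]-pascal n zero    (suc zero)    = refl
C[∸]-pascal n zero    (suc (suc d)) = refl
C[∸]-pascal n (suc r) (suc d) = C[∸]-pascal n r d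

pascal-C[∸] : ∀ a d → Pascal (λ r m → (a + m) C[ r ∸ d ])
pascal-C[∸] a d = record
  { column-zero = λ m → C[0∸]-const (a + suc m) (a + m) d
  ; step        = λ r m → trans (cong (_C[ suc r ∸ d ]) (+-suc a m)) (C[∸]-pascal (a + m) r d)
  }
  where
  C[0∸]-const : ∀ n n′ d → n C[ 0 ∸ d ] ≡ n′ C[ 0 ∸ d ]
  C[0∸]-const n n′ zero    = refl
  C[0∸]-const n n′ (suc d) = refl

completeBipartite : ∀ {m} → (Fin m → Bool) → Graph
completeBipartite {m} side = record
  { order  = m
  ; adj    = λ i j → side i xor side j
  ; sym    = λ i j → xor-comm (side i) (side j)
  ; irrefl = λ i → xor-same (side i)
  }

fourCycle : Graph
fourCycle = completeBipartite (lookup (false ∷ false ∷ true ∷ true ∷ []))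

k-fourCycle : ∀ r → k r fourCycle + 2 * (2 C[ r ∸ 2 ]) ≡ 4 C r + 0 C[ r ∸ 4 ]
k-fourCycle 0 = refl
k-fourCycle 1 = refl
k-fourCycle 2 = refl
k-fourCycle 3 = refl
k-fourCycle 4 = refl
k-fourCycle (suc (suc (suc (suc (suc r))))) = refl

k-coneⁿ-fourCycle : ∀ r m →
  k r (coneⁿ m fourCycle) + 2 * ((2 + m) C[ r ∸ 2 ]) ≡ (4 + m) C r + m C[ r ∸ 4 ]
k-coneⁿ-fourCycle = pascal-unique
  (pascal-+ (pascal-k-coneⁿ fourCycle) (pascal-* 2 (pascal-C[∸] 2 2)))
  (pascal-+ (pascal-C[∸] 4 0) (pascal-C[∸] 0 4))
  k-fourCycle

theorem6 : (n : ℕ) → 4 ≤ n →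
    Σ Graph λ g →
      (k 3 g + 2 * (n ∸ 2) ≤ n C 3) ×
      (n C 5 + (n ∸ 4) ≤ k 5 g + 2 * ((n ∸ 2) C 3))
theorem6 (suc (suc (suc (suc m)))) (s≤s (s≤s (s≤s (s≤s z≤n)))) =
  coneⁿ m fourCycle , ≤-reflexive triangles , ≤-reflexive (≡-sym pentagons)
  where
  open ≡-Reasoning
  triangles : k 3 (coneⁿ m fourCycle) + 2 * (2 + m) ≡ (4 + m) C 3
  triangles = begin
    k 3 (coneⁿ m fourCycle) + 2 * (2 + m)         ≡⟨ cong (λ x → k 3 (coneⁿ m fourCycle) + 2 * x) (≡-sym (nC1≡n (2 + m))) ⟩
    k 3 (coneⁿ m fourCycle) + 2 * ((2 + m) C 1)   ≡⟨ k-coneⁿ-fourCycle 3 m ⟩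
    (4 + m) C 3 + 0                               ≡⟨ +-identityʳ _ ⟩
    (4 + m) C 3 ∎
  pentagons : k 5 (coneⁿ m fourCycle) + 2 * ((2 + m) C 3) ≡ (4 + m) C 5 + m
  pentagons = trans (k-coneⁿ-fourCycle 5 m) (cong ((4 + m) C 5 +_) (nC1≡n m))
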